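{- Let $(T_0, \ldots, T_k)$ be the cocoon of a $p$-caterpillar $T$ with wrapper $\widetilde{T}$, and let $\mathcal{C}_j$ be a $T_j$-cover in $\widetilde{T}$ with excess $\varepsilon_j$, in which $B$ is a non-tiny ball containing the root $x_{j+1}$. Suppose $x_{j+1}$ is left-bad in $B$. Then for some $\ell \le h_{j+1}$, an $\ell$-shift at $B$ produces a $T_{j+1}$-cover in $\widetilde{T}$ with excess $\varepsilon_{j+1} \geq \varepsilon_j$.
   Context: A $p$-caterpillar $T$ is a tree with a maximal path (spine) $(v_1,\dots,v_t)$ such that every vertex is within distance $p$ of the spine. Roots are spine vertices of degree $>2$, denoted $x_1,\dots,x_k$ from left to right. Deleting spine edges, root $x_i$ roots a subtree $T[x_i]$ of height $h_i\le p$ with $n_i$ vertices besides $x_i$. A ball of radius $r$ centered at $x$ is $x$ together with all vertices within distance $r$; a spine cover is a set of balls with distinct radii, centered on the spine, covering every vertex. A ball of radius $r$ centered at spine vertex $v_i$ contains spine vertices $v_{i-r},\dots,v_{i+r}$, with left endpoint $v_{i-r}$ and right endpoint $v_{i+r}$. The cocoon of $T$ is the sequence $T_0,\dots,T_k$ with $T_k=T$, where $T_{i-1}$ is obtained from $T_i$ by deleting the $n_i$ non-root vertices of the subtree at $x_i$ and appending a path of $h_i$ new vertices at the rightmost spine vertex. The wrapper $\widetilde{T}$ is $T$ with a path of $\sum_{i=1}^k n_i$ vertices appended at its rightmost spine vertex; each $T_i$ is a subgraph of $\widetilde{T}$. A $T_i$-cover in $\widetilde{T}$ with excess $\varepsilon_i$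 is a spine cover of $T_i$ inside $\widetilde{T}$ that also covers $\varepsilon_i$ spine vertices of $\widetilde{T}-T_i$, where whenever a spine vertex of $\widetilde{T}$ is covered, every spine vertex to its left is covered. A root $x$ is tree-covered by a spine-centered ball $B$ if all vertices of $T[x]$ lie in $B$. A ball is tiny if its radius is less than $p$ and non-tiny otherwise. If a non-tiny ball $B$ contains root $x_j$ but does not tree-cover it, $x_j$ is left-bad in $B$ if $x_j$ is left of the center of $B$ at distance less than $h_j$ from its left endpoint. Writing a cover as $B_1,\dots,B_s$ ordered by centers left to right, an $\ell$-shift at $B_j$ moves the centers of $B_j,\dots,B_s$ each $\ell$ vertices to the left along the spine, leaving the other balls fixed. -}

module Defs where

open import Data.Nat using (ℕ; zero; suc; _+_; _∸_; _≤_; _<_; _⊔_; ∣_-_∣; _≤?_)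
open import Data.List using (List; []; _∷_)
import Data.Fin as Fin
open import Data.Fin using (Fin; toℕ) renaming (_<_ to _<ᶠ_; _≤_ to _≤ᶠ_; _≤?_ to _≤ᶠ?_)
open import Data.Product using (_×_; _,_; proj₁; proj₂; ∃)
open import Relation.Nullary using (¬_; yes; no)
open import Relation.Binary.PropositionalEquality using (_≡_)
open import Function.Definitions using (Injective)

data RTree : Set where
  node : List RTree → RTree

-- Non-root vertices of a rooted tree.
--   top    : the root of the first child subtree
--   down v : a non-root vertex v inside the first child subtree
--   next v : a non-root vertex among the remaining child subtrees
data Vert : RTree → Set where
  top  : ∀ {t ts} → Vert (node (t ∷ ts))
  down : ∀ {t ts} → Vert t → Vert (node (t ∷ ts))
  next : ∀ {t ts} → Vert (node ts) → Vert (node (t ∷ ts))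

depth : ∀ {T} → Vert T → ℕ
depth top      = 1
depth (down v) = suc (depth v)
depth (next v) = depth v

size : RTree → ℕ
size (node [])       = 0
size (node (t ∷ ts)) = suc (size t) + size (node ts)

height : RTree → ℕ
height (node [])       = 0
height (node (t ∷ ts)) = suc (height t) ⊔ height (node ts)

ΣFin : (k : ℕ) → (Fin k → ℕ) → ℕ
ΣFin zero    f = 0
ΣFin (suc k) f = f Fin.zero + ΣFin k (λ i → f (Fin.suc i))

-- The spine is v_1, …, v_len (spine vertex v_y is identified with y).
-- The roots x_1, …, x_k (here indexed by Fin k, so index i is x_{i+1})
-- sit at spine positions pos i, strictly increasing from left to right.
-- Deleting spine edges, root x leaves the rooted tree sub i = T[x]; all
-- non-root spine vertices have no hanging vertices.
--  * maximal path: the endpoints v_1, v_len are leaves, so roots are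
--    interior spine vertices (2 ≤ pos i < len);
--  * roots have degree > 2: T[x] has at least one non-root vertex;
--  * every vertex within distance p of the spine: height T[x] ≤ p.

record Caterpillar (p : ℕ) : Set where
  field
    len          : ℕ
    len≥1        : 1 ≤ len
    k            : ℕ
    pos          : Fin k → ℕ
    sub          : Fin k → RTree
    pos-inner    : ∀ i → 2 ≤ pos i × pos i < len
    pos-incr     : ∀ i j → i <ᶠ j → pos i < pos j
    sub-nonempty : ∀ i → 1 ≤ size (sub i)
    height≤p     : ∀ i → height (sub i) ≤ p

module _ {p : ℕ} (T : Caterpillar p) where
  open Caterpillar T

  h : Fin k → ℕ
  h i = height (sub i)

  n : Fin k → ℕ
  n i = size (sub i)

  -- Spine length of the wrapper T̃ (T with a path of Σ n_i vertices
  -- appended at v_len).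
  wrapLen : ℕ
  wrapLen = len + ΣFin k n

  -- Spine length of the cocoon member T_j (0 ≤ j ≤ k): T_j keeps the
  -- subtrees of x_1..x_j and has paths of lengths h_{j+1},…,h_k
  -- appended at the right end of the spine.  Inside T̃, these appended
  -- vertices are the first Σ_{m>j} h_m vertices of the wrapper's path.
  cocoonLen : ℕ → ℕ
  cocoonLen j = len + ΣFin k (λ i → removedHeight j i)
    where
    removedHeight : ℕ → Fin k → ℕ
    removedHeight j i with j ≤? toℕ i
    ... | yes _ = h i
    ... | no  _ = 0

-- Balls and covers inside the wrapper T̃.
-- A ball is (center , radius), its center a spine vertex of T̃.

Ball : Set
Ball = ℕ × ℕ

center : Ball → ℕ
center = proj₁

radius : Ball → ℕ
radius = proj₂

module _ {p : ℕ} (T : Caterpillar p) where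
  open Caterpillar T

  inBallSpine : Ball → ℕ → Set
  inBallSpine B y = ∣ y - center B ∣ ≤ radius B

  -- non-root vertex v of T[x_i] lies in ball B (distance in the tree
  -- from v_c to v is |pos i - c| + depth v)
  inBallSub : Ball → (i : Fin k) → Vert (sub i) → Set
  inBallSub B i v = ∣ pos i - center B ∣ + depth v ≤ radius B

  containsRoot : Ball → Fin k → Set
  containsRoot B i = inBallSpine B (pos i)

  treeCovers : Ball → Fin k → Set
  treeCovers B i = containsRoot B i × (∀ v → inBallSub B i v)

  tiny : Ball → Set
  tiny B = radius B < p

  -- x_i is left-bad in the non-tiny ball B: B contains x_i but does not
  -- tree-cover it, x_i is left of the center of B, and the distance of
  -- x_i from the left endpoint v_{c-r} of B is less than h_i, i.e.
  -- pos i - (c - r) < h i (read over the integers).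
  leftBad : Ball → Fin k → Set
  leftBad B i = containsRoot B i × ¬ treeCovers B i
              × pos i < center B × pos i + radius B < center B + h T i

  SpineCovered : ∀ {s} → (Fin s → Ball) → ℕ → Set
  SpineCovered C y = ∃ λ b → inBallSpine (C b) y

  record IsCover (j : ℕ) {s : ℕ} (C : Fin s → Ball) (ε : ℕ) : Set where
    field
      centered      : ∀ b → 1 ≤ center (C b) × center (C b) ≤ wrapLen T
      distinctRadii : Injective _≡_ _≡_ (λ b → radius (C b))
      coverSpine    : ∀ y → 1 ≤ y → y ≤ cocoonLen T j → SpineCovered C y
      coverSub      : ∀ i → toℕ i < j → ∀ v → ∃ λ b → inBallSub (C b) i v
      leftClosed    : ∀ y z → 1 ≤ y → y ≤ z → z ≤ wrapLen T →
                      SpineCovered C z → SpineCovered C y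
      -- exactly ε spine vertices of T̃ - T_j are covered (given the
      -- left-closedness, these are the vertices at positions
      -- cocoonLen j + 1, …, cocoonLen j + ε)
      excessFits    : cocoonLen T j + ε ≤ wrapLen T
      excessExact   : ∀ y → cocoonLen T j < y → y ≤ wrapLen T →
                      (SpineCovered C y → y ≤ cocoonLen T j + ε)
                      × (y ≤ cocoonLen T j + ε → SpineCovered C y)

  OrderedByCenters : ∀ {s} → (Fin s → Ball) → Set
  OrderedByCenters C = ∀ a b → a ≤ᶠ b → center (C a) ≤ center (C b)

shift : ∀ {s} → (Fin s → Ball) → Fin s → ℕ → (Fin s → Ball)
shift C b ℓ a with b ≤ᶠ? a
... | yes _ = (center (C a) ∸ ℓ , radius (C a))
... | no  _ = C a

{-# OPTIONS --safe #-}
-- Move B and every ball to its right left by ℓ = c ∸ (x + (r ∸ h)), where c and r are the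
-- center and radius of B, x is the position of the root and h the height of its subtree.
-- Since B contains the root and the root is left-bad, 0 < ℓ ≤ h, and afterwards B is centered
-- r ∸ h to the right of x, so it tree-covers x.  The spine of T_{j+1} is that of T_j
-- shortened by h ≥ ℓ, so a spine vertex y of T_{j+1} is covered by whichever ball covered
-- y + ℓ: a moved ball carries y + ℓ to y, and if an unmoved ball covers y + ℓ but not y, then
-- y lies left of the center of B, where the ball that covered it either still reaches it
-- after moving towards it or hands it over to the moved B (as ℓ ≤ r).  The same argument
-- preserves left-closedness, and the new excess, the rightmost covered spine vertex of the
-- wrapper minus the spine length of T_{j+1}, is at least ε because the covered prefix
-- shrinks by only ℓ ≤ h.
module Submission where

open import Defs
open import Data.Nat using (ℕ; suc; _≤_)
open import Data.Fin using (Fin; toℕ)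
open import Data.Product using (_×_; ∃)
open import Relation.Nullary using (¬_)

open import Data.Empty using (⊥-elim)
open import Data.Fin using (zero; suc) renaming (_≤_ to _≤ᶠ_; _<_ to _<ᶠ_; _≤?_ to _≤ᶠ?_)
import Data.Fin.Properties as Finₚ
open import Data.Fin.Properties using (any?; toℕ-injective) renaming (_≟_ to _≟ᶠ_)
open import Data.List using (_∷_)
open import Data.Nat using (zero; _+_; _∸_; _<_; z≤n; s≤s; _≤?_; ∣_-_∣)
open import Data.Nat.Properties
open import Algebra.Properties.CommutativeSemigroup +-commutativeSemigroup using (xy∙z≈xz∙y)
open import Data.Product using (_,_; proj₁; proj₂; map₂)
open import Data.Sum using (_⊎_; inj₁; inj₂)
open import Function using (_∘_)
open import Function.Definitions using (Injective)
open import Relation.Nullary using (Dec; yes; no)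
open import Relation.Unary using (Decidable)
open import Relation.Binary.PropositionalEquality

∣m-n∣≤o⇒m≤n+o : ∀ {m n o} → ∣ m - n ∣ ≤ o → m ≤ n + o
∣m-n∣≤o⇒m≤n+o {m} {n} le = ≤-trans (m≤n+∣m-n∣ m n) (+-monoʳ-≤ n le)

∣m-n∣≤o⇒n≤m+o : ∀ {m n o} → ∣ m - n ∣ ≤ o → n ≤ m + o
∣m-n∣≤o⇒n≤m+o {m} {n} le = ∣m-n∣≤o⇒m≤n+o (subst (_≤ _) (∣-∣-comm m n) le)

m≤n+o∧n≤m+o⇒∣m-n∣≤o : ∀ {m n o} → m ≤ n + o → n ≤ m + o → ∣ m - n ∣ ≤ o
m≤n+o∧n≤m+o⇒∣m-n∣≤o {m} {n} {o} m≤n+o n≤m+o with ≤-total m n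
... | inj₁ m≤n = subst (_≤ o) (sym (m≤n⇒∣m-n∣≡n∸m m≤n)) (m≤n+o⇒m∸n≤o n m n≤m+o)
... | inj₂ n≤m = subst (_≤ o) (sym (m≤n⇒∣n-m∣≡n∸m n≤m)) (m≤n+o⇒m∸n≤o m n m≤n+o)

∣n-n∣≤o : ∀ n o → ∣ n - n ∣ ≤ o
∣n-n∣≤o n o = subst (_≤ o) (sym (∣n-n∣≡0 n)) z≤n

∣-∣≤-convex : ∀ {x y z c r} → x ≤ y → y ≤ z → ∣ x - c ∣ ≤ r → ∣ z - c ∣ ≤ r → ∣ y - c ∣ ≤ r
∣-∣≤-convex {r = r} x≤y y≤z x∈ z∈ = m≤n+o∧n≤m+o⇒∣m-n∣≤o
  (≤-trans y≤z (∣m-n∣≤o⇒m≤n+o z∈)) (≤-trans (∣m-n∣≤o⇒n≤m+o x∈) (+-monoˡ-≤ r x≤y))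

∣-∣≰⇒<center : ∀ {y z c r} → y ≤ z → ∣ z - c ∣ ≤ r → ¬ ∣ y - c ∣ ≤ r → y < c
∣-∣≰⇒<center {y} {z} {c} {r} y≤z z∈ y∉ with c ≤? y
... | yes c≤y = ⊥-elim (y∉ (∣-∣≤-convex c≤y y≤z (∣n-n∣≤o c r) z∈))
... | no  c≰y = ≰⇒> c≰y

∣m+o-n∣≡∣m-n∸o∣ : ∀ m {n o} → o ≤ n → ∣ m + o - n ∣ ≡ ∣ m - (n ∸ o) ∣
∣m+o-n∣≡∣m-n∸o∣ m {n} {o} o≤n = begin
  ∣ m + o - n ∣             ≡⟨ cong₂ ∣_-_∣ (+-comm m o) (sym (m+[n∸m]≡n o≤n)) ⟩
  ∣ o + m - o + (n ∸ o) ∣   ≡⟨ ∣m+n-m+o∣≡∣n-o∣ o m (n ∸ o) ⟩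
  ∣ m - (n ∸ o) ∣           ∎
  where open ≡-Reasoning

∣m-n∣≤∣m-o∣ : ∀ {m n o} → m ≤ n → n ≤ o → ∣ m - n ∣ ≤ ∣ m - o ∣
∣m-n∣≤∣m-o∣ {m} m≤n n≤o = subst₂ _≤_ (sym (m≤n⇒∣m-n∣≡n∸m m≤n))
  (sym (m≤n⇒∣m-n∣≡n∸m (≤-trans m≤n n≤o))) (∸-monoˡ-≤ m n≤o)

depth≤height : ∀ {t} (v : Vert t) → depth v ≤ height t
depth≤height {node (t ∷ ts)} top      = ≤-trans (s≤s z≤n) (m≤m⊔n _ (height (node ts)))
depth≤height {node (t ∷ ts)} (down v) = ≤-trans (s≤s (depth≤height v)) (m≤m⊔n _ (height (node ts)))
depth≤height {node (t ∷ ts)} (next v) = ≤-trans (depth≤height v) (m≤n⊔m (suc (height t)) _)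

ΣFin-cong : ∀ {k} {f g : Fin k → ℕ} → (∀ m → f m ≡ g m) → ΣFin k f ≡ ΣFin k g
ΣFin-cong {zero}  f≗g = refl
ΣFin-cong {suc k} f≗g = cong₂ _+_ (f≗g zero) (ΣFin-cong (f≗g ∘ suc))

ΣFin-update : ∀ {k} {f g : Fin k → ℕ} (i : Fin k) {x} →
  (∀ m → m ≢ i → f m ≡ g m) → f i ≡ g i + x → ΣFin k f ≡ ΣFin k g + x
ΣFin-update {suc k} {f} {g} zero {x} f≗g fi = begin
  f zero + ΣFin k (f ∘ suc)        ≡⟨ cong₂ _+_ fi (ΣFin-cong (λ m → f≗g (suc m) (λ ()))) ⟩
  g zero + x + ΣFin k (g ∘ suc)    ≡⟨ xy∙z≈xz∙y (g zero) x _ ⟩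
  g zero + ΣFin k (g ∘ suc) + x    ∎
  where open ≡-Reasoning
ΣFin-update {suc k} {f} {g} (suc i) {x} f≗g fi = begin
  f zero + ΣFin k (f ∘ suc)        ≡⟨ cong₂ _+_ (f≗g zero (λ ())) (ΣFin-update i f∘suc≗g∘suc fi) ⟩
  g zero + (ΣFin k (g ∘ suc) + x)  ≡⟨ sym (+-assoc (g zero) _ x) ⟩
  g zero + ΣFin k (g ∘ suc) + x    ∎
  where
  open ≡-Reasoning
  f∘suc≗g∘suc : ∀ m → m ≢ i → f (suc m) ≡ g (suc m)
  f∘suc≗g∘suc m m≢i = f≗g (suc m) (m≢i ∘ Finₚ.suc-injective)

module _ {P : ℕ → Set} (P? : Decidable P) where

  lastBelow : ℕ → ℕ
  lastBelow zero    = zero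
  lastBelow (suc n) with P? (suc n)
  ... | yes _ = suc n
  ... | no  _ = lastBelow n

  lastBelow-≤ : ∀ n → lastBelow n ≤ n
  lastBelow-≤ zero    = z≤n
  lastBelow-≤ (suc n) with P? (suc n)
  ... | yes _ = ≤-refl
  ... | no  _ = m≤n⇒m≤1+n (lastBelow-≤ n)

  lastBelow-maximal : ∀ {y} n → 1 ≤ y → y ≤ n → P y → y ≤ lastBelow n
  lastBelow-maximal zero    1≤y y≤0 _  = ⊥-elim (<⇒≱ 1≤y y≤0)
  lastBelow-maximal (suc n) 1≤y y≤n Py with P? (suc n)
  ... | yes _   = y≤n
  ... | no  ¬Pn with m≤n⇒m<n∨m≡n y≤n
  ...   | inj₁ y<n  = lastBelow-maximal n 1≤y (m<1+n⇒m≤n y<n) Py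
  ...   | inj₂ refl = ⊥-elim (¬Pn Py)

  lastBelow-satisfies : ∀ n → 1 ≤ lastBelow n → P (lastBelow n)
  lastBelow-satisfies (suc n) 1≤last with P? (suc n)
  ... | yes Pn = Pn
  ... | no  _  = lastBelow-satisfies n 1≤last

module _ {p} (T : Caterpillar p) where
  open Caterpillar T

  -- Defs hides the summand of cocoonLen in an anonymous where-block; unification recovers it.
  private
    summandOf : ∀ {a} {f : Fin k → ℕ} → a ≡ len + ΣFin k f → Fin k → ℕ
    summandOf {f = f} _ = f

  removedHeight : ℕ → Fin k → ℕ
  removedHeight j = summandOf (refl {x = cocoonLen T j})

  removedHeight-≥ : ∀ {j m} → j ≤ toℕ m → removedHeight j m ≡ h T m
  removedHeight-≥ {j} {m} j≤m with j ≤? toℕ m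
  ... | yes _   = refl
  ... | no  j≰m = ⊥-elim (j≰m j≤m)

  removedHeight-< : ∀ {j m} → toℕ m < j → removedHeight j m ≡ 0
  removedHeight-< {j} {m} m<j with j ≤? toℕ m
  ... | yes j≤m = ⊥-elim (<⇒≱ m<j j≤m)
  ... | no  _   = refl

  cocoonLen-suc : ∀ i → cocoonLen T (toℕ i) ≡ cocoonLen T (suc (toℕ i)) + h T i
  cocoonLen-suc i = trans (cong (len +_) (ΣFin-update i removedHeight≗ removedHeight-i))
                          (sym (+-assoc len _ (h T i)))
    where
    removedHeight-i : removedHeight (toℕ i) i ≡ removedHeight (suc (toℕ i)) i + h T i
    removedHeight-i = trans (removedHeight-≥ {m = i} ≤-refl)
                            (cong (_+ h T i) (sym (removedHeight-< {m = i} ≤-refl)))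
    removedHeight≗ : ∀ m → m ≢ i → removedHeight (toℕ i) m ≡ removedHeight (suc (toℕ i)) m
    removedHeight≗ m m≢i with ≤-total (toℕ i) (toℕ m)
    ... | inj₁ i≤m = trans (removedHeight-≥ i≤m)
                           (sym (removedHeight-≥ (≤∧≢⇒< i≤m (m≢i ∘ toℕ-injective ∘ sym))))
    ... | inj₂ m≤i = trans (removedHeight-< m<i) (sym (removedHeight-< (m<n⇒m<1+n m<i)))
      where
      m<i : toℕ m < toℕ i
      m<i = ≤∧≢⇒< m≤i (m≢i ∘ toℕ-injective)

  1≤cocoonLen : ∀ j → 1 ≤ cocoonLen T j
  1≤cocoonLen j = ≤-trans len≥1 (m≤m+n len _)

  LeftClosedUpTo : ∀ {s} → (Fin s → Ball) → ℕ → Set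
  LeftClosedUpTo C W = ∀ y z → 1 ≤ y → y ≤ z → z ≤ W → SpineCovered T C z → SpineCovered T C y

  inBallSpine? : ∀ B y → Dec (inBallSpine T B y)
  inBallSpine? B y = ∣ y - center B ∣ ≤? radius B

  spineCovered? : ∀ {s} (C : Fin s → Ball) → Decidable (SpineCovered T C)
  spineCovered? C y = any? (λ a → inBallSpine? (C a) y)

  lastCovered : ∀ {s} → (Fin s → Ball) → ℕ
  lastCovered C = lastBelow (spineCovered? C) (wrapLen T)

  module _ {s} (C : Fin s → Ball) where

    lastCovered-≤ : lastCovered C ≤ wrapLen T
    lastCovered-≤ = lastBelow-≤ (spineCovered? C) (wrapLen T)

    lastCovered-maximal : ∀ {y} → 1 ≤ y → y ≤ wrapLen T → SpineCovered T C y → y ≤ lastCovered C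
    lastCovered-maximal = lastBelow-maximal (spineCovered? C) (wrapLen T)

    ≤lastCovered⇒covered : LeftClosedUpTo C (wrapLen T) →
      ∀ {y} → 1 ≤ y → y ≤ lastCovered C → SpineCovered T C y
    ≤lastCovered⇒covered leftClosed 1≤y y≤last = leftClosed _ _ 1≤y y≤last lastCovered-≤
      (lastBelow-satisfies (spineCovered? C) (wrapLen T) (≤-trans 1≤y y≤last))

    ≤lastCovered∸ : ∀ {L e} → 1 ≤ L + e → L + e ≤ wrapLen T → SpineCovered T C (L + e) →
      e ≤ lastCovered C ∸ L
    ≤lastCovered∸ {L} {e} 1≤L+e L+e≤W covered =
      m+n≤o⇒m≤o∸n e (subst (_≤ lastCovered C) (+-comm L e)
                              (lastCovered-maximal 1≤L+e L+e≤W covered))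

    isCover-lastCovered : ∀ {j} →
      (∀ a → 1 ≤ center (C a) × center (C a) ≤ wrapLen T) →
      Injective _≡_ _≡_ (radius ∘ C) →
      cocoonLen T j ≤ wrapLen T →
      (∀ y → 1 ≤ y → y ≤ cocoonLen T j → SpineCovered T C y) →
      (∀ m → toℕ m < j → ∀ v → ∃ λ a → inBallSub T (C a) m v) →
      LeftClosedUpTo C (wrapLen T) →
      IsCover T j C (lastCovered C ∸ cocoonLen T j)
    isCover-lastCovered {j} centered distinct L≤W coverSpine coverSub leftClosed = record
      { centered      = centered
      ; distinctRadii = distinct
      ; coverSpine    = coverSpine
      ; coverSub      = coverSub
      ; leftClosed    = leftClosed
      ; excessFits    = subst (_≤ wrapLen T) (sym L+ε≡last) lastCovered-≤
      ; excessExact   = λ y L<y y≤W →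
          (λ covered → subst (y ≤_) (sym L+ε≡last) (lastCovered-maximal (1≤ L<y) y≤W covered)) ,
          (λ y≤L+ε → ≤lastCovered⇒covered leftClosed (1≤ L<y) (subst (y ≤_) L+ε≡last y≤L+ε))
      }
      where
      L = cocoonLen T j
      1≤ : ∀ {y} → L < y → 1 ≤ y
      1≤ L<y = ≤-trans (s≤s z≤n) L<y
      L+ε≡last : L + (lastCovered C ∸ L) ≡ lastCovered C
      L+ε≡last = m+[n∸m]≡n
        (lastCovered-maximal (1≤cocoonLen j) L≤W (coverSpine L (1≤cocoonLen j) ≤-refl))

  covered-up-to-excess : ∀ {j s} {C : Fin s → Ball} {ε} → IsCover T j C ε →
    ∀ y → 1 ≤ y → y ≤ cocoonLen T j + ε → SpineCovered T C y
  covered-up-to-excess {j} cover y 1≤y y≤L+ε with y ≤? cocoonLen T j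
  ... | yes y≤L = coverSpine y 1≤y y≤L
    where open IsCover cover
  ... | no  y≰L = proj₂ (excessExact y (≰⇒> y≰L) (≤-trans y≤L+ε excessFits)) y≤L+ε
    where open IsCover cover

module _ {s} {C : Fin s → Ball} {b : Fin s} {ℓ : ℕ} where

  shift-moved : ∀ {a} → b ≤ᶠ a → shift C b ℓ a ≡ (center (C a) ∸ ℓ , radius (C a))
  shift-moved {a} b≤a with b ≤ᶠ? a
  ... | yes _   = refl
  ... | no  b≰a = ⊥-elim (b≰a b≤a)

  shift-fixed : ∀ {a} → a <ᶠ b → shift C b ℓ a ≡ C a
  shift-fixed {a} a<b with b ≤ᶠ? a
  ... | yes b≤a = ⊥-elim (<⇒≱ a<b b≤a)
  ... | no  _   = refl

  shift-radius : ∀ a → radius (shift C b ℓ a) ≡ radius (C a)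
  shift-radius a with b ≤ᶠ? a
  ... | yes _ = refl
  ... | no  _ = refl

module ShiftedCover {p} (T : Caterpillar p) {s} (C : Fin s → Ball) (ordered : OrderedByCenters T C)
    (b : Fin s) (ℓ : ℕ) (ℓ≤r : ℓ ≤ radius (C b)) (ℓ≤c : ℓ ≤ center (C b)) where
  open Caterpillar T

  C′ : Fin s → Ball
  C′ = shift C b ℓ

  c : ℕ
  c = center (C b)

  -- Splitting on b ≤ᶠ? a itself would also abstract it inside the definition of shift C b ℓ a.
  moved-or-fixed : (a : Fin s) → b ≤ᶠ a ⊎ a <ᶠ b
  moved-or-fixed a = ≤-<-connex (toℕ b) (toℕ a)

  moved-center≥ : ∀ {a} → b ≤ᶠ a → c ≤ center (C a)
  moved-center≥ {a} = ordered b a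

  fixed-center≤ : ∀ {a} → a <ᶠ b → center (C a) ≤ c
  fixed-center≤ {a} a<b = ordered a b (<⇒≤ a<b)

  C′-radius : ∀ a → radius (C′ a) ≡ radius (C a)
  C′-radius = shift-radius {C = C} {b = b} {ℓ = ℓ}

  moved-∣-∣ : ∀ {a} y → b ≤ᶠ a → ∣ y - center (C′ a) ∣ ≡ ∣ y + ℓ - center (C a) ∣
  moved-∣-∣ {a} y b≤a rewrite shift-moved {C = C} {ℓ = ℓ} b≤a =
    sym (∣m+o-n∣≡∣m-n∸o∣ y (≤-trans ℓ≤c (moved-center≥ b≤a)))

  moved-∋ : ∀ {a} y → b ≤ᶠ a → inBallSpine T (C a) (y + ℓ) → inBallSpine T (C′ a) y
  moved-∋ {a} y b≤a = subst₂ _≤_ (sym (moved-∣-∣ y b≤a)) (sym (C′-radius a))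

  moved-∋⁻ : ∀ {a} y → b ≤ᶠ a → inBallSpine T (C′ a) y → inBallSpine T (C a) (y + ℓ)
  moved-∋⁻ {a} y b≤a = subst₂ _≤_ (moved-∣-∣ y b≤a) (C′-radius a)

  fixed-∋ : ∀ {a} y → a <ᶠ b → inBallSpine T (C a) y → SpineCovered T C′ y
  fixed-∋ {a} y a<b y∈a = a , subst (λ B → inBallSpine T B y) (sym (shift-fixed a<b)) y∈a

  covered-left-of-center : ∀ {y} → y < c → SpineCovered T C y → SpineCovered T C′ y
  covered-left-of-center {y} y<c (a , y∈a) with moved-or-fixed a
  ... | inj₂ a<b = fixed-∋ y a<b y∈a
  ... | inj₁ b≤a with y + ℓ ≤? center (C a)
  ...   | yes y+ℓ≤ca =
    a , moved-∋ y b≤a (∣-∣≤-convex (m≤m+n y ℓ) y+ℓ≤ca y∈a (∣n-n∣≤o (center (C a)) _))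
  ...   | no  y+ℓ≰ca =
    b , moved-∋ y ≤-refl (m≤n+o∧n≤m+o⇒∣m-n∣≤o (+-mono-≤ (<⇒≤ y<c) ℓ≤r)
      (≤-trans (moved-center≥ b≤a) (≤-trans (<⇒≤ (≰⇒> y+ℓ≰ca)) (m≤m+n (y + ℓ) _))))

  fixed-covers-left : ∀ {a y z} → a <ᶠ b → y ≤ z → inBallSpine T (C a) z →
    SpineCovered T C y → SpineCovered T C′ y
  fixed-covers-left {a} {y} a<b y≤z z∈a y-covered with inBallSpine? T (C a) y
  ... | yes y∈a = fixed-∋ y a<b y∈a
  ... | no  y∉a =
    covered-left-of-center (<-≤-trans (∣-∣≰⇒<center y≤z z∈a y∉a) (fixed-center≤ a<b)) y-covered

  module _ {W} (leftClosed : LeftClosedUpTo T C W) where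

    covered-shifted : ∀ {y} → 1 ≤ y → y + ℓ ≤ W → SpineCovered T C (y + ℓ) → SpineCovered T C′ y
    covered-shifted {y} 1≤y y+ℓ≤W (a , y+ℓ∈a) with moved-or-fixed a
    ... | inj₁ b≤a = a , moved-∋ y b≤a y+ℓ∈a
    ... | inj₂ a<b = fixed-covers-left a<b (m≤m+n y ℓ) y+ℓ∈a
                      (leftClosed y (y + ℓ) 1≤y (m≤m+n y ℓ) y+ℓ≤W (a , y+ℓ∈a))

    shift-leftClosed : (∀ a → center (C a) ≤ W) → LeftClosedUpTo T C′ W
    shift-leftClosed center≤W y z 1≤y y≤z z≤W (a , z∈a′) with moved-or-fixed a
    ... | inj₁ b≤a with inBallSpine? T (C a) (y + ℓ)
    ...   | yes y+ℓ∈a = a , moved-∋ y b≤a y+ℓ∈a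
    ...   | no  y+ℓ∉a = covered-shifted 1≤y (≤-trans (<⇒≤ y+ℓ<ca) (center≤W a))
              (leftClosed (y + ℓ) (center (C a)) (≤-trans 1≤y (m≤m+n y ℓ)) (<⇒≤ y+ℓ<ca) (center≤W a)
                 (a , ∣n-n∣≤o (center (C a)) _))
      where
      y+ℓ<ca : y + ℓ < center (C a)
      y+ℓ<ca = ∣-∣≰⇒<center (+-monoˡ-≤ ℓ y≤z) (moved-∋⁻ z b≤a z∈a′) y+ℓ∉a
    shift-leftClosed center≤W y z 1≤y y≤z z≤W (a , z∈a′) | inj₂ a<b =
      fixed-covers-left a<b y≤z z∈a (leftClosed y z 1≤y y≤z z≤W (a , z∈a))
      where
      z∈a : inBallSpine T (C a) z
      z∈a = subst (λ B → inBallSpine T B z) (shift-fixed a<b) z∈a′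

  shift-injectiveRadii : Injective _≡_ _≡_ (radius ∘ C) → Injective _≡_ _≡_ (radius ∘ C′)
  shift-injectiveRadii injective {a} {a′} eq =
    injective (trans (sym (C′-radius a)) (trans eq (C′-radius a′)))

  shift-centered : ∀ {W} → 1 ≤ c ∸ ℓ → (∀ a → 1 ≤ center (C a) × center (C a) ≤ W) →
    ∀ a → 1 ≤ center (C′ a) × center (C′ a) ≤ W
  shift-centered {W} 1≤c∸ℓ centered a with moved-or-fixed a
  ... | inj₁ b≤a rewrite shift-moved {C = C} {ℓ = ℓ} b≤a =
    ≤-trans 1≤c∸ℓ (∸-monoˡ-≤ ℓ (moved-center≥ b≤a)) ,
    ≤-trans (m∸n≤m (center (C a)) ℓ) (proj₂ (centered a))
  ... | inj₂ a<b rewrite shift-fixed {C = C} {ℓ = ℓ} a<b = centered a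

  shift-∋-sub : ∀ {m} v {a} → pos m ≤ c ∸ ℓ → inBallSub T (C a) m v → inBallSub T (C′ a) m v
  shift-∋-sub {m} v {a} m≤c∸ℓ m∈a with moved-or-fixed a
  ... | inj₂ a<b rewrite shift-fixed {C = C} {ℓ = ℓ} a<b = m∈a
  ... | inj₁ b≤a rewrite shift-moved {C = C} {ℓ = ℓ} b≤a =
    ≤-trans (+-monoˡ-≤ (depth v) (∣m-n∣≤∣m-o∣ m≤ca∸ℓ (m∸n≤m (center (C a)) ℓ))) m∈a
    where
    m≤ca∸ℓ : pos m ≤ center (C a) ∸ ℓ
    m≤ca∸ℓ = ≤-trans m≤c∸ℓ (∸-monoˡ-≤ ℓ (moved-center≥ b≤a))

module LeftBadShift {p} (T : Caterpillar p) (i : Fin (Caterpillar.k T))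
    {s : ℕ} (C : Fin s → Ball) (ε : ℕ) (b : Fin s)
    (ordered : OrderedByCenters T C)
    (cover : IsCover T (toℕ i) C ε)
    (nonTiny : ¬ tiny T (C b))
    (x∈B : containsRoot T (C b) i)
    (bad : leftBad T (C b) i) where
  open Caterpillar T
  open IsCover cover

  c r x H L L′ : ℕ
  c = center (C b)
  r = radius (C b)
  x = pos i
  H = h T i
  L = cocoonLen T (toℕ i)
  L′ = cocoonLen T (suc (toℕ i))

  c′ : ℕ
  c′ = x + (r ∸ H)

  ℓ : ℕ
  ℓ = c ∸ c′

  H≤r : H ≤ r
  H≤r = ≤-trans (height≤p i) (≮⇒≥ nonTiny)

  c′+H≡x+r : c′ + H ≡ x + r
  c′+H≡x+r = trans (+-assoc x (r ∸ H) H) (cong (x +_) (m∸n+n≡m H≤r))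

  c′≤c : c′ ≤ c
  c′≤c = <⇒≤ (+-cancelʳ-< H c′ c (subst (_< c + H) (sym c′+H≡x+r) x+r<c+H))
    where
    x+r<c+H : x + r < c + H
    x+r<c+H = proj₂ (proj₂ (proj₂ bad))

  ℓ≤H : ℓ ≤ H
  ℓ≤H = m≤n+o⇒m∸n≤o c c′ (subst (c ≤_) (sym c′+H≡x+r) (∣m-n∣≤o⇒n≤m+o x∈B))

  c∸ℓ≡c′ : c ∸ ℓ ≡ c′
  c∸ℓ≡c′ = m∸[m∸n]≡n c′≤c

  open ShiftedCover T C ordered b ℓ (≤-trans ℓ≤H H≤r) (m∸n≤m c c′) hiding (c)

  x≤c∸ℓ : x ≤ c ∸ ℓ
  x≤c∸ℓ = subst (x ≤_) (sym c∸ℓ≡c′) (m≤m+n x (r ∸ H))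

  B′-treeCovers : ∀ v → inBallSub T (C′ b) i v
  B′-treeCovers v
    rewrite shift-moved {C = C} {ℓ = ℓ} (Finₚ.≤-refl {x = b}) | c∸ℓ≡c′ | ∣m-m+n∣≡n x (r ∸ H) =
    subst (r ∸ H + depth v ≤_) (m∸n+n≡m H≤r) (+-monoʳ-≤ (r ∸ H) (depth≤height v))

  L≡L′+H : L ≡ L′ + H
  L≡L′+H = cocoonLen-suc T i

  L′+ε≤W : L′ + ε ≤ wrapLen T
  L′+ε≤W = ≤-trans (+-monoˡ-≤ ε (subst (L′ ≤_) (sym L≡L′+H) (m≤m+n L′ H))) excessFits

  1≤L′+ε : 1 ≤ L′ + ε
  1≤L′+ε = ≤-trans (1≤cocoonLen T (suc (toℕ i))) (m≤m+n L′ ε)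

  C′-covered-up-to-excess : ∀ y → 1 ≤ y → y ≤ L′ + ε → SpineCovered T C′ y
  C′-covered-up-to-excess y 1≤y y≤L′+ε =
    covered-shifted leftClosed 1≤y (≤-trans y+ℓ≤L+ε excessFits)
      (covered-up-to-excess T cover (y + ℓ) (≤-trans 1≤y (m≤m+n y ℓ)) y+ℓ≤L+ε)
    where
    y+ℓ≤L+ε : y + ℓ ≤ L + ε
    y+ℓ≤L+ε = begin
      y + ℓ        ≤⟨ +-mono-≤ y≤L′+ε ℓ≤H ⟩
      L′ + ε + H   ≡⟨ xy∙z≈xz∙y L′ ε H ⟩
      L′ + H + ε   ≡⟨ cong (_+ ε) L≡L′+H ⟨
      L + ε        ∎
      where open ≤-Reasoning

  C′-coverSub : ∀ m → toℕ m < suc (toℕ i) → ∀ v → ∃ λ a → inBallSub T (C′ a) m v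
  C′-coverSub m m≤i v with m ≟ᶠ i
  ... | yes refl = b , B′-treeCovers v
  ... | no  m≢i  = map₂ (shift-∋-sub v (≤-trans (<⇒≤ (pos-incr m i m<i)) x≤c∸ℓ)) (coverSub m m<i v)
    where
    m<i : toℕ m < toℕ i
    m<i = ≤∧≢⇒< (m<1+n⇒m≤n m≤i) (m≢i ∘ toℕ-injective)

  ε′ : ℕ
  ε′ = lastCovered T C′ ∸ L′

  C′-isCover : IsCover T (suc (toℕ i)) C′ ε′
  C′-isCover = isCover-lastCovered T C′
    (shift-centered (≤-trans (≤-trans (s≤s z≤n) (proj₁ (pos-inner i))) x≤c∸ℓ) centered)
    (shift-injectiveRadii distinctRadii)
    (≤-trans (m≤m+n L′ ε) L′+ε≤W)
    (λ y 1≤y y≤L′ → C′-covered-up-to-excess y 1≤y (≤-trans y≤L′ (m≤m+n L′ ε)))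
    C′-coverSub
    (shift-leftClosed leftClosed (proj₂ ∘ centered))

  ε≤ε′ : ε ≤ ε′
  ε≤ε′ = ≤lastCovered∸ T C′ 1≤L′+ε L′+ε≤W (C′-covered-up-to-excess (L′ + ε) 1≤L′+ε ≤-refl)

mainTheorem4 : ∀ {p} (T : Caterpillar p) (i : Fin (Caterpillar.k T))
    {s : ℕ} (C : Fin s → Ball) (ε : ℕ) (b : Fin s) →
    OrderedByCenters T C →
    IsCover T (toℕ i) C ε →
    ¬ tiny T (C b) →
    containsRoot T (C b) i →
    leftBad T (C b) i →
    ∃ λ ℓ → ℓ ≤ h T i × ∃ λ ε′ → IsCover T (suc (toℕ i)) (shift C b ℓ) ε′ × ε ≤ ε′
mainTheorem4 T i C ε b ordered cover nonTiny x∈B bad = ℓ , ℓ≤H , ε′ , C′-isCover , ε≤ε′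
  where open LeftBadShift T i C ε b ordered cover nonTiny x∈B bad
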